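{- Let $\vec\alpha\,F$ be an $n$-ary BNF and $\sim$ a type-polymorphic family of relations on $\vec\alpha\,F$ which at every type is an equivalence relation, satisfies $x\sim y\Rightarrow\mathrm{map}_F\,\vec f\,x\sim\mathrm{map}_F\,\vec f\,y$ for all $\vec f$, and satisfies the two conditions (WI) and (PP) below at all types. Let $\vec\alpha\,Q=\vec\alpha\,F/{\sim}$ with $\mathrm{map}_Q$ and $\mathrm{set}_{Q,i}$ as defined below. Then $\mathrm{set}_{Q,i}$ is a natural transformation, i.e. $\mathrm{set}_{Q,i}\,(\mathrm{map}_Q\,\vec f\,[x]_\sim)=f_i\langle\mathrm{set}_{Q,i}\,[x]_\sim\rangle$, and therefore $\mathrm{set}_{Q,i}\,[\mathrm{map}_F\,\vec f\,x]_\sim=f_i\langle\mathrm{set}_{Q,i}\,[x]_\sim\rangle$.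
   Context: HOL setting (all types non-empty); vector notation $\vec x=x_1,\dots,x_n$. An $n$-ary BNF is a type constructor $\vec\alpha\,F$ with polymorphic mapper $\mathrm{map}_F::(\alpha_1\to\beta_1)\to\cdots\to(\alpha_n\to\beta_n)\to\vec\alpha\,F\to\vec\beta\,F$, setters $\mathrm{set}_{F,i}::\vec\alpha\,F\to\alpha_i\ \mathrm{set}$, infinite cardinal bound $\mathrm{bd}_F$, relator $\mathrm{rel}_F$, satisfying: $\mathrm{map}_F\,\vec{\mathrm{id}}=\mathrm{id}$; $\mathrm{map}_F\,\vec g\circ\mathrm{map}_F\,\vec f=\mathrm{map}_F\,\overrightarrow{(g\circ f)}$; $\mathrm{set}_{F,i}(\mathrm{map}_F\,\vec f\,x)=f_i\langle\mathrm{set}_{F,i}\,x\rangle$; if $f_i z=g_i z$ for all $i$ and $z\in\mathrm{set}_{F,i}\,x$ then $\mathrm{map}_F\,\vec f\,x=\mathrm{map}_F\,\vec g\,x$; $|\mathrm{set}_{F,i}\,x|\le\mathrm{bd}_F$; $(x,y)\in\mathrm{rel}_F\,\vec R$ iff some $z$ has $\mathrm{set}_{F,i}\,z\subseteq R_i$ for all $i$, $\mathrm{map}_F\,\overrightarrow{\mathrm{fst}}\,z=x$, $\mathrm{map}_F\,\overrightarrow{\mathrm{snd}}\,z=y$; $\mathrm{rel}_F\,\vec R\bullet\mathrm{rel}_F\,\vec S\subseteq\mathrm{rel}_F\,\overrightarrow{(R\bullet S)}$. Notation: $f\langle X\rangle$ image, $f^{ -1}\langle X\rangle$ preimage; $F_{\mathrm{in}}\,\vec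 A=\{x\mid\forall i.\ \mathrm{set}_{F,i}\,x\subseteq A_i\}$; $[x]_\sim=\{y\mid x\sim y\}$, $[A]_\sim=\{[x]_\sim\mid x\in A\}$, $\bigcup[A]_\sim$ = set of elements equivalent to some element of $A$. (WI): for all families $\mathcal A_1,\dots,\mathcal A_n$ with $\mathcal A_i\neq\emptyset$ and $\bigcap\mathcal A_i\neq\emptyset$ for all $i$, $\bigcap\{[F_{\mathrm{in}}\,\vec A]_\sim\mid\forall i.\ A_i\in\mathcal A_i\}\subseteq\big[\bigcap\{F_{\mathrm{in}}\,\vec A\mid\forall i.\ A_i\in\mathcal A_i\}\big]_\sim$. (PP): for all $\vec f$ and $\vec A$ with $f_i^{ -1}\langle A_i\rangle\neq\emptyset$ for all $i$, $(\mathrm{map}_F\,\vec f)^{ -1}\langle\bigcup[F_{\mathrm{in}}\,\vec A]_\sim\rangle\subseteq\bigcup[(\mathrm{map}_F\,\vec f)^{ -1}\langle F_{\mathrm{in}}\,\vec A\rangle]_\sim$. $\mathsf 1+\alpha$ is the sum of the unit type and $\alpha$. The quotient $\vec\alpha\,Q$ consists of the classes $[x]_\sim$, with $\mathrm{map}_Q\,\vec f\,[x]_\sim=[\mathrm{map}_F\,\vec f\,x]_\sim$; $Q_{\mathrm{in}}\,\vec A=\{q\mid\forall\vec f\,\vec g.\ (\forall i.\ \forall a\in A_i.\ f_i\,a=g_i\,a)\longrightarrow\mathrm{map}_Q\,\vec f\,q=\mathrm{map}_Q\,\vec g\,q\}$ with $f_i,g_i::\alpha_i\to\mathsf 1+\alpha_i$;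 and $\mathrm{set}_{Q,i}\,q=\bigcap\{A_i\mid q\in Q_{\mathrm{in}}\,\mathrm{UNIV}\cdots A_i\cdots\mathrm{UNIV}\}$ ($A_i$ at position $i$, the full type $\mathrm{UNIV}$ elsewhere). -}

module Defs where

open import Level using (Level; _⊔_; 0ℓ) renaming (suc to lsuc)
open import Data.Nat using (ℕ)
open import Data.Fin using (Fin; _≟_)
open import Data.Unit using (⊤)
open import Data.Sum using (_⊎_)
open import Data.Product using (Σ; ∃; _×_; _,_; proj₁; proj₂)
open import Relation.Nullary using (yes; no)
open import Relation.Binary.PropositionalEquality using (_≡_; refl)
open import Relation.Binary.Structures using (IsEquivalence)

-- logical equivalence (used for extensional equality of HOL sets-as-predicates)
_⟺_ : ∀ {a b} → Set a → Set b → Set (a ⊔ b)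
P ⟺ Q = (P → Q) × (Q → P)

module _ {n : ℕ} where

  -- a vector of types  α₁ … αₙ  is a family  Fin n → Set
  -- HOL: all types are non-empty
  Inh : (Fin n → Set) → Set
  Inh A = (i : Fin n) → A i

  Fun : (Fin n → Set) → (Fin n → Set) → Set
  Fun A B = (i : Fin n) → A i → B i

  Sub : (Fin n → Set) → Set₁
  Sub A = (i : Fin n) → A i → Set

  Rels : (Fin n → Set) → (Fin n → Set) → Set₁
  Rels A B = (i : Fin n) → A i → B i → Set

  upd : {A : Fin n → Set} (i : Fin n) → (A i → Set) → Sub A
  upd i P j with j ≟ i
  ... | yes refl = P
  ... | no _ = λ _ → ⊤

record BNF (n : ℕ) : Set₁ where
  field
    F    : (Fin n → Set) → Set
    map  : ∀ {A B : Fin n → Set} → Fun A B → F A → F B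
    set  : ∀ {A : Fin n → Set} (i : Fin n) → F A → A i → Set
    Bd   : Set
    rel  : ∀ {A B : Fin n → Set} → Rels A B → F A → F B → Set

    map-id   : ∀ {A} → Inh A → (x : F A) → map (λ i a → a) x ≡ x
    map-comp : ∀ {A B C} → Inh A → Inh B → Inh C →
               (f : Fun A B) (g : Fun B C) (x : F A) →
               map g (map f x) ≡ map (λ i a → g i (f i a)) x
    set-map  : ∀ {A B} → Inh A → Inh B → (f : Fun A B) (x : F A) (i : Fin n) (b : B i) →
               set i (map f x) b ⟺ (∃ λ a → set i x a × f i a ≡ b)
    map-cong : ∀ {A B} → Inh A → Inh B → (f g : Fun A B) (x : F A) →
               (∀ i a → set i x a → f i a ≡ g i a) → map f x ≡ map g x
    -- bd_F is an infinite cardinal (represented by the type Bd)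
    bd-infinite : Σ (ℕ → Bd) λ h → ∀ k l → h k ≡ h l → k ≡ l
    -- |set_{F,i} x| ≤ bd_F : an injection from set_{F,i} x into Bd
    bd-bound : ∀ {A} → Inh A → (x : F A) (i : Fin n) →
               Σ ((a : A i) → set i x a → Bd) λ h →
                 ∀ a b (p : set i x a) (q : set i x b) → h a p ≡ h b q → a ≡ b
    rel-iff  : ∀ {A B} → Inh A → Inh B → (R : Rels A B) (x : F A) (y : F B) →
               rel R x y ⟺
               (Σ (F (λ i → A i × B i)) λ z →
                  (∀ i p → set i z p → R i (proj₁ p) (proj₂ p)) ×
                  map (λ i → proj₁) z ≡ x × map (λ i → proj₂) z ≡ y)
    rel-comp : ∀ {A B C} → Inh A → Inh B → Inh C →
               (R : Rels A B) (S : Rels B C) (x : F A) (y : F B) (z : F C) →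
               rel R x y → rel S y z →
               rel (λ i a c → ∃ λ b → R i a b × S i b c) x z

module Quot {n : ℕ} (B : BNF n) (_∼_ : ∀ {A : Fin n → Set} → BNF.F B A → BNF.F B A → Set) where
  open BNF B

  Fin-in : ∀ {A} → Sub A → F A → Set
  Fin-in P x = ∀ i a → set i x a → P i a

  -- (WI) at the types A; the class [x]∼ is represented by x (classes in the
  -- intersection are exactly [x]∼ for some x since the families are non-empty)
  WI : (A : Fin n → Set) → Set₁
  WI A = (𝓐 : (i : Fin n) → (A i → Set) → Set) →
         (∀ i → ∃ λ P → 𝓐 i P) →
         (∀ i → ∃ λ a → ∀ P → 𝓐 i P → P a) →
         (x : F A) →
         (∀ (P : Sub A) → (∀ i → 𝓐 i (P i)) → ∃ λ y → Fin-in P y × x ∼ y) →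
         ∃ λ z → (∀ (P : Sub A) → (∀ i → 𝓐 i (P i)) → Fin-in P z) × x ∼ z

  PP : (A B' : Fin n → Set) → Set₁
  PP A B' = (f : Fun A B') (P : Sub B') →
            (∀ i → ∃ λ a → P i (f i a)) →
            (x : F A) →
            (∃ λ y → Fin-in P y × map f x ∼ y) →
            ∃ λ z → Fin-in P (map f z) × x ∼ z

  -- q = [x]∼ ∈ Q_in A : map_Q f [x] = map_Q g [x], i.e. [map f x]∼ = [map g x]∼,
  -- i.e. map f x ∼ map g x, for all f g : αᵢ → 1 + αᵢ agreeing on the Aᵢ
  Q-in : ∀ {A} → Sub A → F A → Set
  Q-in {A} P x = (f g : (i : Fin n) → A i → ⊤ ⊎ A i) →
                 (∀ i a → P i a → f i a ≡ g i a) →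
                 map f x ∼ map g x

  setQ : ∀ {A} (i : Fin n) → F A → A i → Set₁
  setQ {A} i x a = (P : A i → Set) → Q-in (upd {A = A} i P) x → P a

module Submission where

-- set_{Q,i} [x] consists of the a such that inj₂ a lies in set_{F,i} z for every z ∼ map inj₂ x
-- (inAllReps): one inclusion tests Q_in with the maps into 1 + α that keep a chosen set and send
-- the rest to the unit point, the other maps representatives of [map inj₂ x] back to 1 + α.
-- Naturality is proved for this description. Images of its points stay in it, since (PP) pulls
-- any representative of [map f x] back along f lifted to 1 + α. Conversely, if no point of the
-- preimage of c were in it, each such point would be missed by some representative, and (WI)
-- merges these into one representative missing the whole preimage, so c would not be in it either.

open import Defs
open import Level using (0ℓ) renaming (suc to lsuc)
open import Data.Nat using (ℕ)
open import Data.Fin using (Fin; _≟_)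
open import Data.Product using (∃; _×_; _,_; proj₁; proj₂)
open import Relation.Binary.PropositionalEquality using (_≡_; _≢_; refl; sym; trans; subst)
open import Relation.Binary.Structures using (IsEquivalence)
open import Axiom.ExcludedMiddle using (ExcludedMiddle)
open import Axiom.Extensionality.Propositional using (Extensionality)

open import Data.Unit using (⊤; tt)
open import Data.Sum using (_⊎_; inj₁; inj₂; [_,_])
open import Data.Sum.Properties using (inj₂-injective)
open import Data.Empty using (⊥; ⊥-elim)
open import Function using (_∘_; const; id)
open import Relation.Nullary using (¬_; yes; no)
open import Relation.Binary.Bundles using (Setoid)
import Relation.Binary.Reasoning.Setoid as SetoidReasoning
open import Axiom.DoubleNegationElimination using (em⇒dne)

module _ {n : ℕ} {X : Fin n → Set} (i : Fin n) where

  upd-self⁻ : (P : X i → Set) {a : X i} → upd {A = X} i P i a → P a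
  upd-self⁻ P p with i ≟ i
  ... | yes refl = p
  ... | no i≢i = ⊥-elim (i≢i refl)

  ⊆upd : (R : Sub X) (k : Fin n) (a : X k) → R k a → upd {A = X} i (R i) k a
  ⊆upd R k a r with k ≟ i
  ... | yes refl = r
  ... | no _ = tt

WI-at : ∀ {n} (B : BNF n) (_∼_ : ∀ {A : Fin n → Set} → BNF.F B A → BNF.F B A → Set)
        {X : Fin n → Set} (i : Fin n) → Inh X → Quot.WI B _∼_ X →
        (𝓑 : (X i → Set) → Set) → ∃ 𝓑 → (∃ λ a → ∀ P → 𝓑 P → P a) →
        (x : BNF.F B X) →
        (∀ P → 𝓑 P → ∃ λ y → (∀ a → BNF.set B i y a → P a) × x ∼ y) →
        ∃ λ z → (∀ P → 𝓑 P → ∀ a → BNF.set B i z a → P a) × x ∼ z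
WI-at {n} B _∼_ {X} i iX wi 𝓑 (P₀ , P₀∈𝓑) (a₀ , a₀∈⋂𝓑) x reps =
  let z , z-in , x∼z = wi 𝓐 (λ k → upd i P₀ k , upd∈𝓐 P₀∈𝓑 k) common x reps-in
  in z , (λ P P∈𝓑 a a∈z → upd-self⁻ i P (z-in (upd i P) (upd∈𝓐 P∈𝓑) i a a∈z)) , x∼z
  where
  open BNF B
  open Quot B _∼_

  𝓐 : (k : Fin n) → (X k → Set) → Set
  𝓐 k Q with k ≟ i
  ... | yes refl = 𝓑 Q
  ... | no _ = ∀ d → Q d

  upd∈𝓐 : ∀ {P} → 𝓑 P → ∀ k → 𝓐 k (upd i P k)
  upd∈𝓐 P∈𝓑 k with k ≟ i
  ... | yes refl = P∈𝓑
  ... | no _ = λ _ → tt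

  𝓐-self : ∀ {Q} → 𝓐 i Q → 𝓑 Q
  𝓐-self Q∈𝓐 with i ≟ i
  ... | yes refl = Q∈𝓐
  ... | no i≢i = ⊥-elim (i≢i refl)

  common : ∀ k → ∃ λ a → ∀ Q → 𝓐 k Q → Q a
  common k with k ≟ i
  ... | yes refl = a₀ , a₀∈⋂𝓑
  ... | no _ = iX k , λ Q Q-univ → Q-univ (iX k)

  reps-in : ∀ P → (∀ k → 𝓐 k (P k)) → ∃ λ y → Fin-in P y × x ∼ y
  reps-in P P∈𝓐 =
    let y , y⊆P , x∼y = reps (P i) (𝓐-self (P∈𝓐 i)) in y , y-in y⊆P , x∼y
    where
    y-in : ∀ {y} → (∀ a → set i y a → P i a) → Fin-in P y
    y-in y⊆P k d d∈y with k ≟ i | P∈𝓐 k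
    ... | yes refl | _ = y⊆P d d∈y
    ... | no _ | P-univ = P-univ d

module Naturality (em : ExcludedMiddle 0ℓ) {n : ℕ} (B : BNF n)
  (_∼_ : ∀ {A : Fin n → Set} → BNF.F B A → BNF.F B A → Set)
  (∼-equiv : ∀ {A : Fin n → Set} → Inh A → IsEquivalence (_∼_ {A}))
  (∼-map : ∀ {A C : Fin n → Set} → Inh A → Inh C → (f : Fun A C) (x y : BNF.F B A) →
           x ∼ y → BNF.map B f x ∼ BNF.map B f y)
  (i : Fin n) where
  open BNF B
  open Quot B _∼_

  Opt : (Fin n → Set) → Fin n → Set
  Opt X k = ⊤ ⊎ X k

  none : ∀ {X} → Inh (Opt X)
  none k = inj₁ tt

  ∼-setoid : (X : Fin n → Set) → Setoid 0ℓ 0ℓ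
  ∼-setoid X = record { Carrier = F (Opt X) ; _≈_ = _∼_ ; isEquivalence = ∼-equiv none }

  module ∼ {X : Fin n → Set} = Setoid (∼-setoid X)

  embed : ∀ {X} → F X → F (Opt X)
  embed = map (λ _ → inj₂)

  bind : ∀ {X Y} → Fun X (Opt Y) → Fun (Opt X) (Opt Y)
  bind g k = [ const (inj₁ tt) , g k ]

  Opt-map : ∀ {X Y} → Fun X Y → Fun (Opt X) (Opt Y)
  Opt-map f = bind (λ k → inj₂ ∘ f k)

  map-bind-embed : ∀ {X Y} → Inh X → (g : Fun X (Opt Y)) (x : F X) →
                   map (bind g) (embed x) ≡ map g x
  map-bind-embed iX g x = map-comp iX none none (λ _ → inj₂) (bind g) x

  embed-map : ∀ {X Y} → Inh X → Inh Y → (f : Fun X Y) (x : F X) →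
              embed (map f x) ≡ map (Opt-map f) (embed x)
  embed-map iX iY f x =
    trans (map-comp iX iY none f (λ _ → inj₂) x) (sym (map-bind-embed iX _ x))

  inAllReps : ∀ {X} → F X → X i → Set
  inAllReps x a = ∀ z → embed x ∼ z → set i z (inj₂ a)

  setQ⇒inAllReps : ∀ {X} → Inh X → (x : F X) {a : X i} → setQ i x a → inAllReps x a
  setQ⇒inAllReps {X} iX x a∈Q z x∼z = a∈Q (R i) x∈Q-in
    where
    R : Sub X
    R k a = set k z (inj₂ a)

    x∈Q-in : Q-in (upd i (R i)) x
    x∈Q-in f g f≗g = begin
      map f x                ≡⟨ map-bind-embed iX f x ⟨
      map (bind f) (embed x) ≈⟨ ∼-map none none (bind f) _ _ x∼z ⟩
      map (bind f) z         ≡⟨ map-cong none none (bind f) (bind g) z bind-agrees ⟩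
      map (bind g) z         ≈⟨ ∼-map none none (bind g) _ _ x∼z ⟨
      map (bind g) (embed x) ≡⟨ map-bind-embed iX g x ⟩
      map g x                ∎
      where
      open SetoidReasoning (∼-setoid X)
      bind-agrees : ∀ k d → set k z d → bind f k d ≡ bind g k d
      bind-agrees k (inj₁ _) _ = refl
      bind-agrees k (inj₂ a) a∈z = f≗g k a (⊆upd i R k a a∈z)

  mask : ∀ {X} → Sub X → Fun X (Opt X)
  mask P k a with em {P k a}
  ... | yes _ = inj₂ a
  ... | no _ = inj₁ tt

  mask-keeps : ∀ {X} (P : Sub X) k a → P k a → mask P k a ≡ inj₂ a
  mask-keeps P k a p with em {P k a}
  ... | yes _ = refl
  ... | no ¬p = ⊥-elim (¬p p)

  mask-inj₂ : ∀ {X} (P : Sub X) k {a′ a} → mask P k a′ ≡ inj₂ a → P k a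
  mask-inj₂ P k {a′} e with em {P k a′} | e
  ... | yes p | refl = p

  inAllReps⇒setQ : ∀ {X} → Inh X → (x : F X) {a : X i} → inAllReps x a → setQ i x a
  inAllReps⇒setQ iX x {a} a∈reps P x∈Q-in =
    let a′ , _ , masked = proj₁ (set-map iX none (mask (upd i P)) x i (inj₂ a)) a∈masked
    in upd-self⁻ i P (mask-inj₂ (upd i P) i masked)
    where
    a∈masked : set i (map (mask (upd i P)) x) (inj₂ a)
    a∈masked = a∈reps _ (∼.sym (x∈Q-in (mask (upd i P)) (λ _ → inj₂) (mask-keeps (upd i P))))

  inAllReps-map⁺ : ∀ {A C} → Inh A → Inh C → PP (Opt A) (Opt C) →
                   (f : Fun A C) (x : F A) {a : A i} →
                   inAllReps x a → inAllReps (map f x) (f i a)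
  inAllReps-map⁺ {C = C} iA iC pp f x {a} a∈reps z′ fx∼z′ =
    let z , fz-in , x∼z = pp (Opt-map f) P (λ _ → inj₁ tt , inj₂ refl) (embed x)
                            (z′ , (λ _ _ → inj₁) , subst (_∼ z′) (embed-map iA iC f x) fx∼z′)
    in P-some (fz-in i (inj₂ (f i a)) (fa∈fz z x∼z))
    where
    -- The point inj₁ tt, fixed by Opt-map f, makes the preimage condition of (PP)
    -- hold even where set k z′ is empty.
    P : Sub (Opt C)
    P k d = set k z′ d ⊎ d ≡ inj₁ tt

    P-some : ∀ {c} → P i (inj₂ c) → set i z′ (inj₂ c)
    P-some (inj₁ c∈z′) = c∈z′

    fa∈fz : ∀ z → embed x ∼ z → set i (map (Opt-map f) z) (inj₂ (f i a))
    fa∈fz z x∼z = proj₂ (set-map none none (Opt-map f) z i _) (inj₂ a , a∈reps z x∼z , refl)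

  avoiding-rep : ∀ {X} (x : F X) {a : X i} →
                 ¬ inAllReps x a → ∃ λ z → embed x ∼ z × ¬ set i z (inj₂ a)
  avoiding-rep x a∉reps = dne λ ¬avoiding → a∉reps λ z x∼z → dne λ a∉z → ¬avoiding (z , x∼z , a∉z)
    where dne = em⇒dne em

  inAllReps-map⁻ : ∀ {A C} → Inh A → Inh C → WI (Opt A) →
                   (f : Fun A C) (x : F A) {c : C i} →
                   inAllReps (map f x) c → ∃ λ a → inAllReps x a × f i a ≡ c
  inAllReps-map⁻ {A} iA iC wi f x {c} c∈reps = em⇒dne em λ ¬preimage →
    let z , z-avoids , x∼z = WI-at B _∼_ i none wi 𝓑 (const ⊤ , inj₁ λ _ → tt)
                               (inj₁ tt , none∈⋂𝓑) (embed x) (reps ¬preimage)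
        d , d∈z , fd≡c = proj₁ (set-map none none (Opt-map f) z i (inj₂ c)) (c∈reps _ (fx∼fz x∼z))
    in avoids-preimage z-avoids d d∈z fd≡c
    where
    -- A representative whose i-th set lies below every member of 𝓑 misses the whole preimage of c.
    𝓑 : (Opt A i → Set) → Set
    𝓑 Q = (∀ d → Q d) ⊎ ∃ λ a → f i a ≡ c × (∀ d → d ≢ inj₂ a → Q d)

    none∈⋂𝓑 : ∀ Q → 𝓑 Q → Q (inj₁ tt)
    none∈⋂𝓑 Q (inj₁ Q-univ) = Q-univ _
    none∈⋂𝓑 Q (inj₂ (_ , _ , Q⊇∁a)) = Q⊇∁a _ λ ()

    reps : ¬ (∃ λ a → inAllReps x a × f i a ≡ c) →
           ∀ Q → 𝓑 Q → ∃ λ y → (∀ d → set i y d → Q d) × embed x ∼ y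
    reps _ Q (inj₁ Q-univ) = embed x , (λ d _ → Q-univ d) , ∼.refl
    reps ¬preimage Q (inj₂ (a , fa≡c , Q⊇∁a)) =
      let y , x∼y , a∉y = avoiding-rep x λ a∈reps → ¬preimage (a , a∈reps , fa≡c)
      in y , (λ d d∈y → Q⊇∁a d λ { refl → a∉y d∈y }) , x∼y

    fx∼fz : ∀ {z} → embed x ∼ z → embed (map f x) ∼ map (Opt-map f) z
    fx∼fz {z} x∼z = subst (_∼ map (Opt-map f) z) (sym (embed-map iA iC f x))
                          (∼-map none none (Opt-map f) _ _ x∼z)

    avoids-preimage : ∀ {z} → (∀ Q → 𝓑 Q → ∀ d → set i z d → Q d) →
                      ∀ d → set i z d → Opt-map f i d ≡ inj₂ c → ⊥
    avoids-preimage _ (inj₁ _) _ ()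
    avoids-preimage z-avoids (inj₂ a) a∈z fa≡c =
      z-avoids (_≢ inj₂ a) (inj₂ (a , inj₂-injective fa≡c , λ _ → id)) (inj₂ a) a∈z refl

-- Excluded middle at level 0 suffices.
lemma3p13 : ExcludedMiddle 0ℓ → ExcludedMiddle (lsuc 0ℓ) → Extensionality 0ℓ 0ℓ →
  {n : ℕ} (B : BNF n) (_∼_ : ∀ {A : Fin n → Set} → BNF.F B A → BNF.F B A → Set) →
  (∀ {A : Fin n → Set} → Inh A → IsEquivalence (_∼_ {A})) →
  (∀ {A C : Fin n → Set} → Inh A → Inh C → (f : Fun A C) (x y : BNF.F B A) →
     x ∼ y → BNF.map B f x ∼ BNF.map B f y) →
  (∀ {A : Fin n → Set} → Inh A → Quot.WI B _∼_ A) →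
  (∀ {A C : Fin n → Set} → Inh A → Inh C → Quot.PP B _∼_ A C) →
  ∀ {A C : Fin n → Set} → Inh A → Inh C → (f : Fun A C) (x : BNF.F B A) (i : Fin n) (c : C i) →
    Quot.setQ B _∼_ i (BNF.map B f x) c ⟺ (∃ λ a → Quot.setQ B _∼_ i x a × f i a ≡ c)
lemma3p13 em _ _ B _∼_ ∼-equiv ∼-map wi pp iA iC f x i c =
  (λ c∈setQ →
     let a , a∈reps , fa≡c =
           inAllReps-map⁻ iA iC (wi none) f x (setQ⇒inAllReps iC (BNF.map B f x) c∈setQ)
     in a , inAllReps⇒setQ iA x a∈reps , fa≡c)
  , λ { (a , a∈setQ , refl) →
          inAllReps⇒setQ iC (BNF.map B f x)
            (inAllReps-map⁺ iA iC (pp none none) f x (setQ⇒inAllReps iA x a∈setQ)) }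
  where open Naturality em B _∼_ ∼-equiv ∼-map i
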